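{- Let $n\ge2$ and let $\mu=(\mu_1,\ldots,\mu_k)$ be a partition with $\mu\subseteq\delta_n=(n-1,\ldots,1)$. Let $w^{\delta_n/\mu}$ be the permutation obtained from the permutation with one-line notation $2,4,\ldots,2n-2,1,3,\ldots,2n-3$ by successively, for $i=1,2,\ldots,k$, moving the entry $2i-1$ exactly $\mu_i$ positions to the left (the entries it passes shifting one position to the right). Then the set $\mathcal{R}(w^{\delta_n/\mu})$ of reduced words of $w^{\delta_n/\mu}$ is a union of shifted Knuth classes (equivalently, it is closed under shifted Knuth moves).
   Context: Example: for $n=6$, $w^{\delta_6}=2\,4\,6\,8\,10\,1\,3\,5\,7\,9$ and $w^{\delta_6/(3,1)}=2\,4\,1\,6\,8\,3\,10\,5\,7\,9$. Permutations are multiplied as functions ($(uv)(x)=u(v(x))$), written in one-line notation; $s_i=(i,i+1)$; $(a_1,\ldots,a_p)$ is a reduced word of $w$ if $w=s_{a_1}\cdots s_{a_p}$ with $p$ the number of inversions of $w$. The Knuth relations on integer words are $acb\leftrightarrow cab$ when $a\le b<c$ and $bac\leftrightarrow bca$ when $a<b\le c$; a Knuth move applies one to three consecutive letters; a shifted Knuth move is a Knuth move or the exchange of the first two letters. Shifted Knuth classes are the equivalence classes under sequences of shifted Knuth moves. -}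

module Defs where

open import Data.Nat using (ℕ; zero; suc; _+_; _*_; _∸_; _≤_; _<_; _≤?_; _<?_; _≟_)
open import Data.List using (List; []; _∷_; _++_; map; foldr; length; filter; upTo; take; drop; [_])
open import Data.Product using (_×_; _,_; proj₁; proj₂)
open import Data.Bool using (if_then_else_)
open import Relation.Nullary.Decidable using (⌊_⌋)
open import Relation.Binary.PropositionalEquality using (_≡_)

-- Permutations of [N] = {1,…,N} are represented by their one-line notation,
-- a list of naturals of length N.

idPerm : ℕ → List ℕ
idPerm N = map suc (upTo N)

-- 1-indexed value u(x) of a one-line list (fixes x outside the list's range).
apply : List ℕ → ℕ → ℕ
apply []       x             = x
apply (y ∷ ys) zero          = zero
apply (y ∷ ys) (suc zero)    = y
apply (y ∷ ys) (suc (suc x)) = apply ys (suc x)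

compose : List ℕ → List ℕ → List ℕ
compose u v = map (apply u) v

transp : ℕ → ℕ → ℕ
transp i x = if ⌊ x ≟ i ⌋ then suc i else (if ⌊ x ≟ suc i ⌋ then i else x)

simple : ℕ → ℕ → List ℕ
simple N i = map (transp i) (idPerm N)

wordProduct : ℕ → List ℕ → List ℕ
wordProduct N []       = idPerm N
wordProduct N (a ∷ as) = compose (simple N a) (wordProduct N as)

inversions : List ℕ → ℕ
inversions []       = 0
inversions (x ∷ xs) = length (filter (λ y → y <? x) xs) + inversions xs

data LettersIn (N : ℕ) : List ℕ → Set where
  []  : LettersIn N []
  _∷_ : ∀ {a as} → (1 ≤ a × suc a ≤ N) → LettersIn N as → LettersIn N (a ∷ as)

IsReducedWord : List ℕ → List ℕ → Set
IsReducedWord w a =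
  LettersIn (length w) a × (wordProduct (length w) a ≡ w) × (length a ≡ inversions w)

data KnuthMove : List ℕ → List ℕ → Set where
  acb→cab : ∀ p q a b c → a ≤ b → b < c →
            KnuthMove (p ++ a ∷ c ∷ b ∷ q) (p ++ c ∷ a ∷ b ∷ q)
  cab→acb : ∀ p q a b c → a ≤ b → b < c →
            KnuthMove (p ++ c ∷ a ∷ b ∷ q) (p ++ a ∷ c ∷ b ∷ q)
  bac→bca : ∀ p q a b c → a < b → b ≤ c →
            KnuthMove (p ++ b ∷ a ∷ c ∷ q) (p ++ b ∷ c ∷ a ∷ q)
  bca→bac : ∀ p q a b c → a < b → b ≤ c →
            KnuthMove (p ++ b ∷ c ∷ a ∷ q) (p ++ b ∷ a ∷ c ∷ q)

data ShiftedKnuthMove : List ℕ → List ℕ → Set where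
  knuth     : ∀ {u v} → KnuthMove u v → ShiftedKnuthMove u v
  swapFirst : ∀ x y q → ShiftedKnuthMove (x ∷ y ∷ q) (y ∷ x ∷ q)

-- μ = (μ_1, …, μ_k) is a partition (positive, weakly decreasing parts)
-- with μ_i ≤ j + 1 - i, i.e. contained in the staircase (j, j-1, …, 1).
data PartitionInStaircase : ℕ → List ℕ → Set where
  []  : ∀ {j} → PartitionInStaircase j []
  single : ∀ {j m} → 1 ≤ m → m ≤ j → PartitionInStaircase j (m ∷ [])
  _∷_ : ∀ {j m m' ms} → (1 ≤ m × m ≤ j × m' ≤ m) →
        PartitionInStaircase (j ∸ 1) (m' ∷ ms) →
        PartitionInStaircase j (m ∷ m' ∷ ms)

PartitionIn-δ : ℕ → List ℕ → Set
PartitionIn-δ n μ = PartitionInStaircase (n ∸ 1) μ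

breakAt : ℕ → List ℕ → List ℕ × List ℕ
breakAt x []       = [] , []
breakAt x (y ∷ ys) = if ⌊ y ≟ x ⌋ then ([] , ys)
                     else (y ∷ proj₁ (breakAt x ys) , proj₂ (breakAt x ys))

moveLeft : ℕ → ℕ → List ℕ → List ℕ
moveLeft x m l =
  let b = proj₁ (breakAt x l)
      a = proj₂ (breakAt x l)
      k = length b ∸ m
  in take k b ++ x ∷ drop k b ++ a

wDelta : ℕ → List ℕ
wDelta n = map (λ i → 2 * i) (idPerm (n ∸ 1)) ++ map (λ i → 2 * i ∸ 1) (idPerm (n ∸ 1))

moveAll : ℕ → List ℕ → List ℕ → List ℕ
moveAll i []       l = l
moveAll i (m ∷ ms) l = moveAll (suc i) ms (moveLeft (2 * i ∸ 1) m l)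

wSkew : ℕ → List ℕ → List ℕ
wSkew n μ = moveAll 1 μ (wDelta n)

-- In the one-line notation of w = w^{δ_n/μ} the even entries appear in increasing order, and so
-- do the odd ones: since μ_i ≤ μ_{i-1}, the entry 2i-1 only ever moves leftwards across even
-- entries. Hence w contains no pattern 321 and never has x+2 before x. A shifted Knuth move on a
-- reduced word either exchanges two letters differing by at least 2, which commute, or meets a
-- factor xx, a factor xyx, or an initial factor x(x±1). Factors xx, and xyx with |x-y| ≥ 2, can
-- be shortened, so they never occur; a braid factor x(x+1)x or (x+1)x(x+1) forces a pattern 321
-- in w; an initial x(x+1) or (x+1)x forces x+2 before x in w.
module Submission where

open import Defs
open import Data.Nat using (ℕ; zero; suc; _+_; _*_; _∸_; _≤_; _<_; _<?_; _≟_; z≤n; s≤s)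
open import Data.Nat.Properties
open import Data.List using (List; []; _∷_; _++_; map; length; filter; take; drop; applyUpTo; [_])
open import Data.List.Properties using (length-map; length-applyUpTo; length-drop; take++drop≡id; filter-accept; filter-reject; filter-none; filter-all; filter-++; map-applyUpTo; map-∘; map-cong; map-id; ++-assoc; ++-identityʳ; length-++)
open import Data.List.Membership.Propositional using (_∈_; _∉_)
open import Data.List.Membership.DecPropositional _≟_ using (_∈?_)
open import Data.List.Membership.Propositional.Properties using (∈-map⁺; ∈-filter⁺; ∈-++⁺ʳ)
open import Data.List.Relation.Unary.Any using (here; there)
open import Data.List.Relation.Unary.All as All using (All; []; _∷_)
open import Data.List.Relation.Unary.All.Properties as All using ()
open import Data.List.Relation.Unary.AllPairs as AllPairs using (AllPairs; []; _∷_)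
open import Data.List.Relation.Unary.AllPairs.Properties as AllPairs using ()
open import Data.List.Relation.Unary.Unique.Propositional using (Unique)
open import Data.List.Relation.Unary.Unique.Propositional.Properties as Unique using ()
open import Data.Product using (_×_; _,_; proj₁; proj₂)
open import Data.Sum as Sum using (_⊎_; inj₁; inj₂)
open import Data.Empty using (⊥-elim)
open import Data.Unit using (⊤; tt)
open import Data.Bool using (Bool; true; false)
open import Data.Bool.Properties as Boolₚ using (not-¬; ¬-not)
open import Function using (_∘_; id)
open import Relation.Nullary using (¬_; yes; no)
open import Relation.Binary.Definitions using (tri<; tri≈; tri>)
open import Relation.Unary using (Decidable)
open import Relation.Binary.PropositionalEquality hiding ([_])

transp-self : ∀ i → transp i i ≡ suc i
transp-self i with i ≟ i
... | yes _ = refl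
... | no i≢i = ⊥-elim (i≢i refl)

transp-suc : ∀ i → transp i (suc i) ≡ i
transp-suc i with suc i ≟ i
... | yes 1+i≡i = ⊥-elim (1+n≢n 1+i≡i)
... | no _ with suc i ≟ suc i
...   | yes _ = refl
...   | no ≢ = ⊥-elim (≢ refl)

transp-other : ∀ i {x} → x ≢ i → x ≢ suc i → transp i x ≡ x
transp-other i {x} x≢i x≢1+i with x ≟ i
... | yes x≡i = ⊥-elim (x≢i x≡i)
... | no _ with x ≟ suc i
...   | yes x≡1+i = ⊥-elim (x≢1+i x≡1+i)
...   | no _ = refl

data TranspView (i : ℕ) : ℕ → Set where
  at-i     : TranspView i i
  at-suc-i : TranspView i (suc i)
  fixed    : ∀ {x} → x ≢ i → x ≢ suc i → TranspView i x

transpView : ∀ i x → TranspView i x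
transpView i x with x ≟ i
... | yes refl = at-i
... | no x≢i with x ≟ suc i
...   | yes refl = at-suc-i
...   | no x≢1+i = fixed x≢i x≢1+i

transp-2+ : ∀ i → transp i (2 + i) ≡ 2 + i
transp-2+ i = transp-other i (>⇒≢ (≤-trans (n<1+n i) (n≤1+n _))) (>⇒≢ ≤-refl)

transp-pred : ∀ i → transp (suc i) i ≡ i
transp-pred i = transp-other (suc i) (<⇒≢ ≤-refl) (<⇒≢ (≤-trans (n<1+n i) (n≤1+n _)))

transp-involutive : ∀ i x → transp i (transp i x) ≡ x
transp-involutive i x with transpView i x
... | at-i rewrite transp-self i = transp-suc i
... | at-suc-i rewrite transp-suc i = transp-self i
... | fixed x≢i x≢1+i rewrite transp-other i x≢i x≢1+i = transp-other i x≢i x≢1+i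

transp-injective : ∀ i {x y} → transp i x ≡ transp i y → x ≡ y
transp-injective i {x} {y} eq = begin
  x                        ≡⟨ transp-involutive i x ⟨
  transp i (transp i x)    ≡⟨ cong (transp i) eq ⟩
  transp i (transp i y)    ≡⟨ transp-involutive i y ⟩
  y                        ∎
  where open ≡-Reasoning

transp-<-mono : ∀ i {x y} → x < y → ¬ (x ≡ i × y ≡ suc i) → transp i x < transp i y
transp-<-mono i {x} {y} x<y not-i,i+1 with transpView i x | transpView i y
... | at-i | at-i = ⊥-elim (<-irrefl refl x<y)
... | at-i | at-suc-i = ⊥-elim (not-i,i+1 (refl , refl))
... | at-i | fixed y≢i y≢1+i
  rewrite transp-self i | transp-other i y≢i y≢1+i = ≤∧≢⇒< x<y (y≢1+i ∘ sym)
... | at-suc-i | at-i = ⊥-elim (<-asym x<y (n<1+n i))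
... | at-suc-i | at-suc-i = ⊥-elim (<-irrefl refl x<y)
... | at-suc-i | fixed y≢i y≢1+i
  rewrite transp-suc i | transp-other i y≢i y≢1+i = <-trans (n<1+n i) x<y
... | fixed x≢i x≢1+i | at-i
  rewrite transp-self i | transp-other i x≢i x≢1+i = <-trans x<y (n<1+n i)
... | fixed x≢i x≢1+i | at-suc-i
  rewrite transp-suc i | transp-other i x≢i x≢1+i = ≤∧≢⇒< (≤-pred x<y) x≢i
... | fixed x≢i x≢1+i | fixed y≢i y≢1+i
  rewrite transp-other i x≢i x≢1+i | transp-other i y≢i y≢1+i = x<y

transp-range : ∀ {N i x} → 1 ≤ i → suc i ≤ N → 1 ≤ x → x ≤ N → 1 ≤ transp i x × transp i x ≤ N
transp-range {i = i} {x} 1≤i i<N 1≤x x≤N with transpView i x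
... | at-i rewrite transp-self i = s≤s z≤n , i<N
... | at-suc-i rewrite transp-suc i = 1≤i , ≤-trans (n≤1+n i) i<N
... | fixed x≢i x≢1+i rewrite transp-other i x≢i x≢1+i = 1≤x , x≤N

Distant : ℕ → ℕ → Set
Distant a c = 2 + a ≤ c ⊎ 2 + c ≤ a

distant-sym : ∀ {a c} → Distant a c → Distant c a
distant-sym (inj₁ a+2≤c) = inj₂ a+2≤c
distant-sym (inj₂ c+2≤a) = inj₁ c+2≤a

distant-fixes : ∀ {a c} → Distant a c → transp c a ≡ a × transp c (suc a) ≡ suc a
distant-fixes {a} {c} (inj₁ a+2≤c) =
  transp-other c (<⇒≢ (≤-trans (n≤1+n _) a+2≤c)) (<⇒≢ (≤-trans (n≤1+n _) (m≤n⇒m≤1+n a+2≤c))) ,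
  transp-other c (<⇒≢ a+2≤c) (<⇒≢ (m≤n⇒m≤1+n a+2≤c))
distant-fixes {a} {c} (inj₂ c+2≤a) =
  transp-other c (>⇒≢ (≤-trans (n≤1+n _) c+2≤a)) (>⇒≢ c+2≤a) ,
  transp-other c (>⇒≢ (m≤n⇒m≤1+n (≤-trans (n≤1+n _) c+2≤a))) (>⇒≢ (m≤n⇒m≤1+n c+2≤a))

fixed-by-distant : ∀ {a c} → Distant a c → ∀ {z} → z ≢ a → z ≢ suc a → transp a (transp c z) ≡ transp c z
fixed-by-distant {a} {c} d {z} z≢a z≢1+a with transpView c z
... | at-i = trans (cong (transp a) (transp-self c)) (trans (proj₂ (distant-fixes (distant-sym d))) (sym (transp-self c)))
... | at-suc-i = trans (cong (transp a) (transp-suc c)) (trans (proj₁ (distant-fixes (distant-sym d))) (sym (transp-suc c)))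
... | fixed z≢c z≢1+c = trans (cong (transp a) c-fixes) (trans (transp-other a z≢a z≢1+a) (sym c-fixes))
  where c-fixes = transp-other c z≢c z≢1+c

transp-comm : ∀ {a c} → Distant a c → ∀ z → transp a (transp c z) ≡ transp c (transp a z)
transp-comm {a} {c} d z with transpView a z
... | at-i = begin
  transp a (transp c a)   ≡⟨ cong (transp a) (proj₁ (distant-fixes d)) ⟩
  transp a a              ≡⟨ transp-self a ⟩
  suc a                   ≡⟨ proj₂ (distant-fixes d) ⟨
  transp c (suc a)        ≡⟨ cong (transp c) (transp-self a) ⟨
  transp c (transp a a)   ∎
  where open ≡-Reasoning
... | at-suc-i = begin
  transp a (transp c (suc a))   ≡⟨ cong (transp a) (proj₂ (distant-fixes d)) ⟩
  transp a (suc a)              ≡⟨ transp-suc a ⟩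
  a                             ≡⟨ proj₁ (distant-fixes d) ⟨
  transp c a                    ≡⟨ cong (transp c) (transp-suc a) ⟨
  transp c (transp a (suc a))   ∎
  where open ≡-Reasoning
... | fixed z≢a z≢1+a = trans (fixed-by-distant d z≢a z≢1+a) (cong (transp c) (sym (transp-other a z≢a z≢1+a)))

InRange : ℕ → List ℕ → Set
InRange N = All (λ y → 1 ≤ y × y ≤ N)

apply-applyUpTo : ∀ (f : ℕ → ℕ) {N x} → x < N → apply (applyUpTo f N) (suc x) ≡ f x
apply-applyUpTo f {suc N} {zero} _ = refl
apply-applyUpTo f {suc (suc N)} {suc x} (s≤s x<N) = apply-applyUpTo (f ∘ suc) x<N

simple≡applyUpTo : ∀ N a → simple N a ≡ applyUpTo (transp a ∘ suc) N
simple≡applyUpTo N a = trans (cong (map (transp a)) (map-applyUpTo id suc N)) (map-applyUpTo suc (transp a) N)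

apply-simple : ∀ N a {x} → 1 ≤ x → x ≤ N → apply (simple N a) x ≡ transp a x
apply-simple N a {suc x} _ x<N =
  trans (cong (λ l → apply l (suc x)) (simple≡applyUpTo N a)) (apply-applyUpTo (transp a ∘ suc) x<N)

compose-simple : ∀ {N} a {X} → InRange N X → compose (simple N a) X ≡ map (transp a) X
compose-simple a [] = refl
compose-simple a ((1≤x , x≤N) ∷ inRange) = cong₂ _∷_ (apply-simple _ a 1≤x x≤N) (compose-simple a inRange)

idPerm-sorted : ∀ N → AllPairs _<_ (idPerm N)
idPerm-sorted N = subst (AllPairs _<_) (sym (map-applyUpTo id suc N)) (AllPairs.applyUpTo⁺₁ suc N (λ i<j _ → s≤s i<j))

idPerm-inRange : ∀ N → InRange N (idPerm N)
idPerm-inRange N = subst (InRange N) (sym (map-applyUpTo id suc N)) (All.applyUpTo⁺₁ suc N (λ i<N → s≤s z≤n , i<N))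

wordProduct-inRange : ∀ {N as} → LettersIn N as → InRange N (wordProduct N as)
wordProduct-inRange {N} [] = idPerm-inRange N
wordProduct-inRange {as = a ∷ _} ((1≤a , a<N) ∷ letters) =
  subst (InRange _) (sym (compose-simple a inRange)) (All.map⁺ (All.map transp-inRange inRange))
  where
  inRange = wordProduct-inRange letters
  transp-inRange : ∀ {x} → 1 ≤ x × x ≤ _ → 1 ≤ transp a x × transp a x ≤ _
  transp-inRange (1≤x , x≤N) = transp-range 1≤a a<N 1≤x x≤N

wordProduct-∷ : ∀ {N a as} → LettersIn N (a ∷ as) → wordProduct N (a ∷ as) ≡ map (transp a) (wordProduct N as)
wordProduct-∷ {a = a} (_ ∷ letters) = compose-simple a (wordProduct-inRange letters)

wordProduct-unique : ∀ {N as} → LettersIn N as → Unique (wordProduct N as)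
wordProduct-unique {N} [] = AllPairs.map <⇒≢ (idPerm-sorted N)
wordProduct-unique {as = a ∷ _} letters@(_ ∷ letters′) =
  subst Unique (sym (wordProduct-∷ letters)) (Unique.map⁺ (transp-injective a) (wordProduct-unique letters′))

data Before (a b : ℕ) : List ℕ → Set where
  here  : ∀ {xs} → b ∈ xs → Before a b (a ∷ xs)
  there : ∀ {y xs} → Before a b xs → Before a b (y ∷ xs)

before-∈ˡ : ∀ {a b L} → Before a b L → a ∈ L
before-∈ˡ (here _) = here refl
before-∈ˡ (there before) = there (before-∈ˡ before)

before-∈ʳ : ∀ {a b L} → Before a b L → b ∈ L
before-∈ʳ (here b∈xs) = there b∈xs
before-∈ʳ (there before) = there (before-∈ʳ before)

before-map : ∀ (f : ℕ → ℕ) {a b L} → Before a b L → Before (f a) (f b) (map f L)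
before-map f (here b∈xs) = here (∈-map⁺ f b∈xs)
before-map f (there before) = there (before-map f before)

before-asym : ∀ {a b L} → Unique L → Before a b L → ¬ Before b a L
before-asym (y∉ys ∷ _) (here a∈ys) (here _) = All.lookup y∉ys a∈ys refl
before-asym (y∉ys ∷ _) (here _) (there b-a) = All.lookup y∉ys (before-∈ʳ b-a) refl
before-asym (y∉ys ∷ _) (there a-b) (here _) = All.lookup y∉ys (before-∈ʳ a-b) refl
before-asym (_ ∷ unique) (there a-b) (there b-a) = before-asym unique a-b b-a

before-trans : ∀ {a b c L} → Unique L → Before a b L → Before b c L → Before a c L
before-trans _ (here _) (here c∈ys) = here c∈ys
before-trans _ (here _) (there b-c) = here (before-∈ʳ b-c)
before-trans (y∉ys ∷ _) (there a-b) (here _) = ⊥-elim (All.lookup y∉ys (before-∈ʳ a-b) refl)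
before-trans (_ ∷ unique) (there a-b) (there b-c) = there (before-trans unique a-b b-c)

before-sorted : ∀ {R : ℕ → ℕ → Set} {a b L} → AllPairs R L → Before a b L → R a b
before-sorted (a≺ys ∷ _) (here b∈ys) = All.lookup a≺ys b∈ys
before-sorted (_ ∷ sorted) (there before) = before-sorted sorted before

-- Inversions and reduced words

countBelow : ℕ → List ℕ → ℕ
countBelow x xs = length (filter (_<? x) xs)

countBelow-∷-< : ∀ {x z} zs → z < x → countBelow x (z ∷ zs) ≡ suc (countBelow x zs)
countBelow-∷-< {x} _ z<x = cong length (filter-accept (_<? x) z<x)

countBelow-∷-≮ : ∀ {x z} zs → ¬ z < x → countBelow x (z ∷ zs) ≡ countBelow x zs
countBelow-∷-≮ {x} _ z≮x = cong length (filter-reject (_<? x) z≮x)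

countBelow-maps-≤ : ∀ (g h : ℕ → ℕ) {y y′} zs → (∀ {z} → z ∈ zs → g z < y′ → h z < y) →
                    countBelow y′ (map g zs) ≤ countBelow y (map h zs)
countBelow-maps-≤ g h [] _ = z≤n
countBelow-maps-≤ g h {y} {y′} (z ∷ zs) below with g z <? y′ | h z <? y
... | yes gz<y′ | yes hz<y
  rewrite countBelow-∷-< (map g zs) gz<y′ | countBelow-∷-< (map h zs) hz<y = s≤s rest
  where rest = countBelow-maps-≤ g h zs (below ∘ there)
... | yes gz<y′ | no hz≮y = ⊥-elim (hz≮y (below (here refl) gz<y′))
... | no gz≮y′ | yes hz<y
  rewrite countBelow-∷-≮ (map g zs) gz≮y′ | countBelow-∷-< (map h zs) hz<y = m≤n⇒m≤1+n rest
  where rest = countBelow-maps-≤ g h zs (below ∘ there)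
... | no gz≮y′ | no hz≮y
  rewrite countBelow-∷-≮ (map g zs) gz≮y′ | countBelow-∷-≮ (map h zs) hz≮y = countBelow-maps-≤ g h zs (below ∘ there)

countBelow-map-≤ : ∀ (g : ℕ → ℕ) {y y′} zs → (∀ {z} → z ∈ zs → g z < y′ → z < y) →
                   countBelow y′ (map g zs) ≤ countBelow y zs
countBelow-map-≤ g {y} zs below =
  subst (countBelow _ (map g zs) ≤_) (cong (countBelow y) (map-id zs)) (countBelow-maps-≤ g id zs below)

countBelow-map-≡ : ∀ (g : ℕ → ℕ) {y y′} zs → (∀ {z} → z ∈ zs → g z < y′ → z < y) → (∀ {z} → z ∈ zs → z < y → g z < y′) →
                   countBelow y′ (map g zs) ≡ countBelow y zs
countBelow-map-≡ g {y} zs below above = ≤-antisym (countBelow-map-≤ g zs below)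
  (subst (_≤ countBelow _ (map g zs)) (cong (countBelow y) (map-id zs)) (countBelow-maps-≤ id g zs above))

countBelow-transp-self : ∀ i ys → suc i ∉ ys → countBelow (suc i) (map (transp i) ys) ≤ countBelow i ys
countBelow-transp-self i ys 1+i∉ys = countBelow-map-≤ (transp i) ys below
  where
  below : ∀ {z} → z ∈ ys → transp i z < suc i → z < i
  below {z} z∈ys tz<1+i with transpView i z
  ... | at-i rewrite transp-self i = ⊥-elim (<-irrefl refl tz<1+i)
  ... | at-suc-i = ⊥-elim (1+i∉ys z∈ys)
  ... | fixed z≢i z≢1+i rewrite transp-other i z≢i z≢1+i = ≤∧≢⇒< (≤-pred tz<1+i) z≢i

countBelow-transp-self-≤ : ∀ i {ys} → Unique ys → countBelow (suc i) (map (transp i) ys) ≤ suc (countBelow i ys)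
countBelow-transp-self-≤ i [] = z≤n
countBelow-transp-self-≤ i {z ∷ zs} (z∉zs ∷ unique) with transpView i z
... | at-suc-i
  rewrite transp-suc i | countBelow-∷-< (map (transp i) zs) (n<1+n i) | countBelow-∷-≮ {i} zs (<-asym (n<1+n i))
  = s≤s (countBelow-transp-self i zs (λ 1+i∈zs → All.lookup z∉zs 1+i∈zs refl))
... | at-i
  rewrite transp-self i | countBelow-∷-≮ (map (transp i) zs) (<-irrefl {suc i} refl) | countBelow-∷-≮ zs (<-irrefl {i} refl)
  = countBelow-transp-self-≤ i unique
... | fixed z≢i z≢1+i rewrite transp-other i z≢i z≢1+i with z <? i
...   | yes z<i rewrite countBelow-∷-< {suc i} (map (transp i) zs) (m<n⇒m<1+n z<i) | countBelow-∷-< zs z<i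
  = s≤s (countBelow-transp-self-≤ i unique)
...   | no z≮i rewrite countBelow-∷-≮ {suc i} (map (transp i) zs) (λ z<1+i → z≮i (≤∧≢⇒< (≤-pred z<1+i) z≢i)) | countBelow-∷-≮ zs z≮i
  = countBelow-transp-self-≤ i unique

countBelow-transp-suc : ∀ i ys → countBelow i (map (transp i) ys) ≤ countBelow (suc i) ys
countBelow-transp-suc i ys = countBelow-map-≤ (transp i) ys below
  where
  below : ∀ {z} → z ∈ ys → transp i z < i → z < suc i
  below {z} _ tz<i with transpView i z
  ... | at-i rewrite transp-self i = ⊥-elim (<-asym tz<i (n<1+n i))
  ... | at-suc-i rewrite transp-suc i = ⊥-elim (<-irrefl refl tz<i)
  ... | fixed z≢i z≢1+i rewrite transp-other i z≢i z≢1+i = m<n⇒m<1+n tz<i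

countBelow-transp-fixed : ∀ i {y} ys → y ≢ i → y ≢ suc i → countBelow (transp i y) (map (transp i) ys) ≡ countBelow y ys
countBelow-transp-fixed i {y} ys y≢i y≢1+i rewrite transp-other i y≢i y≢1+i = countBelow-map-≡ (transp i) ys below above
  where
  ty≡y = transp-other i y≢i y≢1+i
  above : ∀ {z} → z ∈ ys → z < y → transp i z < y
  above _ z<y = subst (_ <_) ty≡y (transp-<-mono i z<y (λ (_ , y≡1+i) → y≢1+i y≡1+i))
  below : ∀ {z} → z ∈ ys → transp i z < y → z < y
  below {z} _ tz<y with <-cmp z y
  ... | tri< z<y _ _ = z<y
  ... | tri≈ _ refl _ = ⊥-elim (<-irrefl ty≡y tz<y)
  ... | tri> _ _ y<z = ⊥-elim (<-asym tz<y (subst (_< transp i z) ty≡y (transp-<-mono i y<z (λ (y≡i , _) → y≢i y≡i))))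

inversions-transp-descent : ∀ i {L} → Unique L →
  inversions (map (transp i) L) ≤ inversions L ⊎ Before i (suc i) L
inversions-transp-descent i [] = inj₁ z≤n
inversions-transp-descent i {y ∷ ys} (_ ∷ unique) with inversions-transp-descent i unique
... | inj₂ i-before-1+i = inj₂ (there i-before-1+i)
... | inj₁ tail≤ with transpView i y
...   | at-i with suc i ∈? ys
...     | yes 1+i∈ys = inj₂ (here 1+i∈ys)
...     | no 1+i∉ys rewrite transp-self i = inj₁ (+-mono-≤ (countBelow-transp-self i ys 1+i∉ys) tail≤)
inversions-transp-descent i {y ∷ ys} _ | inj₁ tail≤ | at-suc-i
  rewrite transp-suc i = inj₁ (+-mono-≤ (countBelow-transp-suc i ys) tail≤)
inversions-transp-descent i {y ∷ ys} _ | inj₁ tail≤ | fixed y≢i y≢1+i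
  = inj₁ (+-mono-≤ (≤-reflexive (countBelow-transp-fixed i ys y≢i y≢1+i)) tail≤)

inversions-transp-≤ : ∀ i {L} → Unique L → inversions (map (transp i) L) ≤ suc (inversions L)
inversions-transp-≤ i [] = z≤n
inversions-transp-≤ i {y ∷ ys} (y∉ys ∷ unique) with transpView i y
... | at-i with inversions-transp-descent i unique
...   | inj₂ i-before-1+i = ⊥-elim (All.lookup y∉ys (before-∈ˡ i-before-1+i) refl)
...   | inj₁ tail≤ rewrite transp-self i = +-mono-≤ (countBelow-transp-self-≤ i unique) tail≤
inversions-transp-≤ i {y ∷ ys} (_ ∷ unique) | at-suc-i rewrite transp-suc i
  = ≤-trans (+-mono-≤ (countBelow-transp-suc i ys) (inversions-transp-≤ i unique)) (≤-reflexive (+-suc _ _))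
inversions-transp-≤ i {y ∷ ys} (_ ∷ unique) | fixed y≢i y≢1+i
  = ≤-trans (+-mono-≤ (≤-reflexive (countBelow-transp-fixed i ys y≢i y≢1+i)) (inversions-transp-≤ i unique))
            (≤-reflexive (+-suc _ _))

sorted⇒inversions≡0 : ∀ {L} → AllPairs _<_ L → inversions L ≡ 0
sorted⇒inversions≡0 [] = refl
sorted⇒inversions≡0 {x ∷ xs} (x<xs ∷ sorted) =
  cong₂ _+_ (cong length (filter-none (_<? x) (All.map <⇒≯ x<xs))) (sorted⇒inversions≡0 sorted)

inversions-∷-≤ : ∀ {N a as} → LettersIn N (a ∷ as) → inversions (wordProduct N (a ∷ as)) ≤ suc (inversions (wordProduct N as))
inversions-∷-≤ {a = a} letters@(_ ∷ letters′) =
  subst (λ w → inversions w ≤ _) (sym (wordProduct-∷ letters)) (inversions-transp-≤ a (wordProduct-unique letters′))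

inversions-wordProduct-≤ : ∀ {N as} → LettersIn N as → inversions (wordProduct N as) ≤ length as
inversions-wordProduct-≤ {N} [] = ≤-reflexive (sorted⇒inversions≡0 (idPerm-sorted N))
inversions-wordProduct-≤ letters@(_ ∷ letters′) = ≤-trans (inversions-∷-≤ letters) (s≤s (inversions-wordProduct-≤ letters′))

ReducedWord : ℕ → List ℕ → Set
ReducedWord N as = LettersIn N as × inversions (wordProduct N as) ≡ length as

reduced-tail : ∀ {N a as} → ReducedWord N (a ∷ as) → ReducedWord N as
reduced-tail (letters@(_ ∷ letters′) , inversions≡) =
  letters′ , ≤-antisym (inversions-wordProduct-≤ letters′) (≤-pred (subst (_≤ _) inversions≡ (inversions-∷-≤ letters)))

reduced-suffix : ∀ {N} p {s} → ReducedWord N (p ++ s) → ReducedWord N s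
reduced-suffix [] reduced = reduced
reduced-suffix (_ ∷ p) reduced = reduced-suffix p (reduced-tail reduced)

-- Otherwise multiplying by s_a would not raise the number of inversions.
reduced-head-before : ∀ {N a as} → ReducedWord N (a ∷ as) → Before a (suc a) (wordProduct N as)
reduced-head-before {N} {a} {as} (letters@(_ ∷ letters′) , inversions≡)
  with inversions-transp-descent a (wordProduct-unique letters′)
... | inj₂ a-before-1+a = a-before-1+a
... | inj₁ inversions≤ = ⊥-elim (1+n≰n (begin
  suc (length as)                                ≡⟨ inversions≡ ⟨
  inversions (wordProduct N (a ∷ as))            ≡⟨ cong inversions (wordProduct-∷ letters) ⟩
  inversions (map (transp a) (wordProduct N as)) ≤⟨ inversions≤ ⟩
  inversions (wordProduct N as)                  ≤⟨ inversions-wordProduct-≤ letters′ ⟩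
  length as                                      ∎))
  where open ≤-Reasoning

reduced-length-≤ : ∀ {N s s′} → LettersIn N s′ → wordProduct N s ≡ wordProduct N s′ → ReducedWord N s → length s ≤ length s′
reduced-length-≤ letters′ same-product (_ , inversions≡) =
  subst (_≤ _) inversions≡ (subst (λ w → inversions w ≤ _) (sym same-product) (inversions-wordProduct-≤ letters′))

letters-swap : ∀ {N} p {a c r} → LettersIn N (p ++ a ∷ c ∷ r) → LettersIn N (p ++ c ∷ a ∷ r)
letters-swap [] (a-in ∷ c-in ∷ letters) = c-in ∷ a-in ∷ letters
letters-swap (_ ∷ p) (e-in ∷ letters) = e-in ∷ letters-swap p letters

map-transp-comm : ∀ {a c} → Distant a c → ∀ X → map (transp a) (map (transp c) X) ≡ map (transp c) (map (transp a) X)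
map-transp-comm d X = trans (sym (map-∘ X)) (trans (map-cong (transp-comm d) X) (map-∘ X))

wordProduct-swap : ∀ {N} p {a c r} → Distant a c → LettersIn N (p ++ a ∷ c ∷ r) →
                   wordProduct N (p ++ a ∷ c ∷ r) ≡ wordProduct N (p ++ c ∷ a ∷ r)
wordProduct-swap {N} [] {a} {c} {r} d letters@(a-in ∷ letters′@(_ ∷ letters″)) = begin
  wordProduct N (a ∷ c ∷ r)                     ≡⟨ wordProduct-∷ letters ⟩
  map (transp a) (wordProduct N (c ∷ r))        ≡⟨ cong (map (transp a)) (wordProduct-∷ letters′) ⟩
  map (transp a) (map (transp c) (wordProduct N r)) ≡⟨ map-transp-comm d _ ⟩
  map (transp c) (map (transp a) (wordProduct N r)) ≡⟨ cong (map (transp c)) (wordProduct-∷ (a-in ∷ letters″)) ⟨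
  map (transp c) (wordProduct N (a ∷ r))        ≡⟨ wordProduct-∷ (letters-swap [] letters) ⟨
  wordProduct N (c ∷ a ∷ r)                     ∎
  where open ≡-Reasoning
wordProduct-swap {N} (e ∷ p) d (_ ∷ letters) = cong (compose (simple N e)) (wordProduct-swap p d letters)

wordProduct-xx : ∀ {N x s} → LettersIn N (x ∷ x ∷ s) → wordProduct N (x ∷ x ∷ s) ≡ wordProduct N s
wordProduct-xx {N} {x} {s} letters@(_ ∷ letters′) = begin
  wordProduct N (x ∷ x ∷ s)                          ≡⟨ wordProduct-∷ letters ⟩
  map (transp x) (wordProduct N (x ∷ s))             ≡⟨ cong (map (transp x)) (wordProduct-∷ letters′) ⟩
  map (transp x) (map (transp x) (wordProduct N s))  ≡⟨ map-∘ _ ⟨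
  map (transp x ∘ transp x) (wordProduct N s)        ≡⟨ map-cong (transp-involutive x) _ ⟩
  map id (wordProduct N s)                           ≡⟨ map-id _ ⟩
  wordProduct N s                                    ∎
  where open ≡-Reasoning

¬reduced-xx : ∀ {N x s} → ¬ ReducedWord N (x ∷ x ∷ s)
¬reduced-xx reduced@(letters@(_ ∷ _ ∷ letters′) , _) =
  1+n≰n (≤-trans (n≤1+n _) (reduced-length-≤ letters′ (wordProduct-xx letters) reduced))

¬reduced-distant-xyx : ∀ {N x y s} → Distant x y → ¬ ReducedWord N (x ∷ y ∷ x ∷ s)
¬reduced-distant-xyx {N} {x} {y} {s} d reduced@(letters@(x-in ∷ y-in ∷ x-in′ ∷ letters′) , _) =
  1+n≰n (≤-trans (n≤1+n _) (reduced-length-≤ (y-in ∷ letters′) same-product reduced))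
  where
  yxx-letters = letters-swap [] letters
  same-product : wordProduct N (x ∷ y ∷ x ∷ s) ≡ wordProduct N (y ∷ s)
  same-product = begin
    wordProduct N (x ∷ y ∷ x ∷ s)          ≡⟨ wordProduct-swap [] d letters ⟩
    wordProduct N (y ∷ x ∷ x ∷ s)          ≡⟨ wordProduct-∷ yxx-letters ⟩
    map (transp y) (wordProduct N (x ∷ x ∷ s)) ≡⟨ cong (map (transp y)) (wordProduct-xx (x-in ∷ x-in′ ∷ letters′)) ⟩
    map (transp y) (wordProduct N s)       ≡⟨ wordProduct-∷ (y-in ∷ letters′) ⟨
    wordProduct N (y ∷ s)                  ∎
    where open ≡-Reasoning

-- Forbidden factors of reduced words of parity-sorted permutations

before-∷ : ∀ {N y s a b a′ b′} → LettersIn N (y ∷ s) → transp y a ≡ a′ → transp y b ≡ b′ →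
           Before a b (wordProduct N s) → Before a′ b′ (wordProduct N (y ∷ s))
before-∷ {y = y} letters refl refl before = subst (Before _ _) (sym (wordProduct-∷ letters)) (before-map (transp y) before)

reduced-ascent-before : ∀ {N x s} → ReducedWord N (x ∷ suc x ∷ s) → Before (2 + x) x (wordProduct N (x ∷ suc x ∷ s))
reduced-ascent-before {x = x} reduced@(letters@(_ ∷ letters′) , _) =
  before-∷ letters (transp-2+ x) (transp-suc x)
    (before-∷ letters′ (transp-self (suc x)) (transp-suc (suc x)) (reduced-head-before (reduced-tail reduced)))

reduced-descent-before : ∀ {N x s} → ReducedWord N (suc x ∷ x ∷ s) → Before (2 + x) x (wordProduct N (suc x ∷ x ∷ s))
reduced-descent-before {x = x} reduced@(letters@(_ ∷ letters′) , _) =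
  before-∷ letters (transp-self (suc x)) (transp-pred x)
    (before-∷ letters′ (transp-self x) (transp-suc x) (reduced-head-before (reduced-tail reduced)))

record Contains321 (L : List ℕ) : Set where
  constructor contains321
  field
    {high mid low}  : ℕ
    mid<high        : mid < high
    low<mid         : low < mid
    high-before-mid : Before high mid L
    mid-before-low  : Before mid low L

reduced-braid↑⇒321 : ∀ {N x s} → ReducedWord N (x ∷ suc x ∷ x ∷ s) → Contains321 (wordProduct N (x ∷ suc x ∷ x ∷ s))
reduced-braid↑⇒321 {x = x} reduced@(letters , _) = contains321 (n<1+n (suc x)) (n<1+n x)
  (before-∷ letters (transp-2+ x) (transp-self x) (reduced-descent-before (reduced-tail reduced)))
  (before-∷ letters (transp-self x) (transp-suc x) (reduced-head-before reduced))

reduced-braid↓⇒321 : ∀ {N x s} → ReducedWord N (suc x ∷ x ∷ suc x ∷ s) → Contains321 (wordProduct N (suc x ∷ x ∷ suc x ∷ s))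
reduced-braid↓⇒321 {x = x} reduced@(letters , _) = contains321 (n<1+n (suc x)) (n<1+n x)
  (before-∷ letters (transp-self (suc x)) (transp-suc (suc x)) (reduced-head-before reduced))
  (before-∷ letters (transp-suc (suc x)) (transp-pred x) (reduced-ascent-before (reduced-tail reduced)))

-- s_e only swaps the values e and e+1, and these occur in the order e, e+1 since the word is reduced.
contains321-∷ : ∀ {N e s} → ReducedWord N (e ∷ s) → Contains321 (wordProduct N s) → Contains321 (wordProduct N (e ∷ s))
contains321-∷ {e = e} reduced@(letters@(_ ∷ letters′) , _) (contains321 mid<high low<mid high-mid mid-low) =
  contains321 (transp-<-mono e mid<high (λ { (refl , refl) → before-asym unique descent high-mid }))
              (transp-<-mono e low<mid (λ { (refl , refl) → before-asym unique descent mid-low }))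
              (before-∷ letters refl refl high-mid)
              (before-∷ letters refl refl mid-low)
  where
  descent = reduced-head-before reduced
  unique = wordProduct-unique letters′

contains321-++ : ∀ {N} p {s} → ReducedWord N (p ++ s) → Contains321 (wordProduct N s) → Contains321 (wordProduct N (p ++ s))
contains321-++ [] _ c321 = c321
contains321-++ (_ ∷ p) reduced c321 = contains321-∷ reduced (contains321-++ p (reduced-tail reduced) c321)

isEven : ℕ → Bool
isEven zero = true
isEven (suc zero) = false
isEven (suc (suc n)) = isEven n

ParitySorted : List ℕ → Set
ParitySorted L = ∀ {y z} → Before y z L → isEven y ≡ isEven z → y < z

paritySorted-¬before-2+ : ∀ {L x} → ParitySorted L → ¬ Before (2 + x) x L
paritySorted-¬before-2+ {x = x} sorted before = <-asym (sorted before refl) (≤-trans (n<1+n x) (n≤1+n _))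

paritySorted-avoids-321 : ∀ {L} → Unique L → ParitySorted L → ¬ Contains321 L
paritySorted-avoids-321 unique sorted (contains321 {high} {mid} {low} mid<high low<mid high-mid mid-low)
  with isEven high Boolₚ.≟ isEven mid | isEven mid Boolₚ.≟ isEven low
... | yes same | _ = <-asym mid<high (sorted high-mid same)
... | _ | yes same = <-asym low<mid (sorted mid-low same)
... | no differ₁ | no differ₂ =
  <-asym (<-trans low<mid mid<high) (sorted (before-trans unique high-mid mid-low) (trans (¬-not differ₁) (sym (¬-not (differ₂ ∘ sym)))))

data LetterGap : ℕ → ℕ → Set where
  equal   : ∀ {x} → LetterGap x x
  ascent  : ∀ {x} → LetterGap x (suc x)
  descent : ∀ {y} → LetterGap (suc y) y
  distant : ∀ {x y} → Distant x y → LetterGap x y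

letterGap : ∀ x y → LetterGap x y
letterGap zero zero = equal
letterGap zero (suc zero) = ascent
letterGap zero (suc (suc y)) = distant (inj₁ (s≤s (s≤s z≤n)))
letterGap (suc zero) zero = descent
letterGap (suc (suc x)) zero = distant (inj₂ (s≤s (s≤s z≤n)))
letterGap (suc x) (suc y) with letterGap x y
... | equal = equal
... | ascent = ascent
... | descent = descent
... | distant d = distant (Sum.map s≤s s≤s d)

isReducedWord-swap : ∀ {w} p {a c r} → Distant a c → IsReducedWord w (p ++ a ∷ c ∷ r) → IsReducedWord w (p ++ c ∷ a ∷ r)
isReducedWord-swap p d (letters , product≡ , length≡) =
  letters-swap p letters , trans (sym (wordProduct-swap p d letters)) product≡ , trans (trans (length-++ p) (sym (length-++ p))) length≡

¬reduced-xyx : ∀ {N} p {x y q} → x ≢ y → ParitySorted (wordProduct N (p ++ x ∷ y ∷ x ∷ q)) → ¬ ReducedWord N (p ++ x ∷ y ∷ x ∷ q)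
¬reduced-xyx p {x} {y} x≢y sorted reduced with letterGap x y
... | equal = x≢y refl
... | ascent = paritySorted-avoids-321 unique sorted (contains321-++ p reduced (reduced-braid↑⇒321 (reduced-suffix p reduced)))
  where unique = wordProduct-unique (proj₁ reduced)
... | descent = paritySorted-avoids-321 unique sorted (contains321-++ p reduced (reduced-braid↓⇒321 (reduced-suffix p reduced)))
  where unique = wordProduct-unique (proj₁ reduced)
... | distant d = ¬reduced-distant-xyx d (reduced-suffix p reduced)

shiftedKnuthMove-preserves-reduced : ∀ {w u v} → ParitySorted w → IsReducedWord w u → ShiftedKnuthMove u v → IsReducedWord w v
shiftedKnuthMove-preserves-reduced {w} {u} w-sorted isReduced@(letters , product≡ , length≡) = move-preserves
  where
  reduced : ReducedWord (length w) u
  reduced = letters , trans (cong inversions product≡) (sym length≡)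
  sorted : ParitySorted (wordProduct (length w) u)
  sorted = subst ParitySorted (sym product≡) w-sorted
  swap-after : ∀ p b {a c r} → Distant a c → IsReducedWord w (p ++ b ∷ a ∷ c ∷ r) → IsReducedWord w (p ++ b ∷ c ∷ a ∷ r)
  swap-after p b d reduced′ = subst (IsReducedWord w) (++-assoc p [ b ] _)
    (isReducedWord-swap (p ++ [ b ]) d (subst (IsReducedWord w) (sym (++-assoc p [ b ] _)) reduced′))
  move-preserves : ∀ {v} → ShiftedKnuthMove u v → IsReducedWord w v
  move-preserves (knuth (acb→cab p q a b c a≤b b<c)) with m≤n⇒m<n∨m≡n a≤b
  ... | inj₁ a<b = isReducedWord-swap p (inj₁ (≤-trans (s≤s a<b) b<c)) isReduced
  ... | inj₂ refl = ⊥-elim (¬reduced-xyx p (<⇒≢ b<c) sorted reduced)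
  move-preserves (knuth (cab→acb p q a b c a≤b b<c)) with m≤n⇒m<n∨m≡n a≤b
  ... | inj₁ a<b = isReducedWord-swap p (inj₂ (≤-trans (s≤s a<b) b<c)) isReduced
  ... | inj₂ refl = ⊥-elim (¬reduced-xx (reduced-tail (reduced-suffix p reduced)))
  move-preserves (knuth (bac→bca p q a b c a<b b≤c)) with m≤n⇒m<n∨m≡n b≤c
  ... | inj₁ b<c = swap-after p b (inj₁ (≤-trans (s≤s a<b) b<c)) isReduced
  ... | inj₂ refl = ⊥-elim (¬reduced-xyx p (>⇒≢ a<b) sorted reduced)
  move-preserves (knuth (bca→bac p q a b c a<b b≤c)) with m≤n⇒m<n∨m≡n b≤c
  ... | inj₁ b<c = swap-after p b (inj₂ (≤-trans (s≤s a<b) b<c)) isReduced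
  ... | inj₂ refl = ⊥-elim (¬reduced-xx (reduced-suffix p reduced))
  move-preserves (swapFirst x y q) with letterGap x y
  ... | equal = ⊥-elim (¬reduced-xx reduced)
  ... | ascent = ⊥-elim (paritySorted-¬before-2+ sorted (reduced-ascent-before reduced))
  ... | descent = ⊥-elim (paritySorted-¬before-2+ sorted (reduced-descent-before reduced))
  ... | distant d = isReducedWord-swap [] d isReduced

-- The permutation w^{δ_n/μ} is parity-sorted

Even Odd : ℕ → Set
Even y = isEven y ≡ true
Odd y = isEven y ≡ false

isEven-double : ∀ i → Even (2 * i)
isEven-double zero = refl
isEven-double (suc i) = trans (cong isEven (*-suc 2 i)) (isEven-double i)

isEven-suc-double : ∀ i → Odd (suc (2 * i))
isEven-suc-double zero = refl
isEven-suc-double (suc i) = trans (cong (isEven ∘ suc) (*-suc 2 i)) (isEven-suc-double i)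

isEven-odd-entry : ∀ i → Odd (2 * suc i ∸ 1)
isEven-odd-entry i = trans (cong (isEven ∘ (_∸ 1)) (*-suc 2 i)) (isEven-suc-double i)

parityPart : Bool → List ℕ → List ℕ
parityPart b = filter (λ y → isEven y Boolₚ.≟ b)

before-filter : ∀ {P : ℕ → Set} (P? : Decidable P) {a b L} → Before a b L → P a → P b → Before a b (filter P? L)
before-filter P? {a} (here b∈ys) Pa Pb with P? a
... | yes _ = here (∈-filter⁺ P? b∈ys Pb)
... | no ¬Pa = ⊥-elim (¬Pa Pa)
before-filter P? {L = y ∷ _} (there before) Pa Pb with P? y
... | yes _ = there (before-filter P? before Pa Pb)
... | no _ = before-filter P? before Pa Pb

paritySorted-from-parts : ∀ {L} → (∀ b → AllPairs _<_ (parityPart b L)) → ParitySorted L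
paritySorted-from-parts parts {y} before same = before-sorted (parts (isEven y)) (before-filter _ before refl (sym same))

filter-move-left : ∀ {P : ℕ → Set} (P? : Decidable P) {x} D C → ¬ P x ⊎ All (¬_ ∘ P) D →
                   filter P? (D ++ x ∷ C) ≡ filter P? (x ∷ D ++ C)
filter-move-left P? {x} D C (inj₁ ¬Px) = begin
  filter P? (D ++ x ∷ C)              ≡⟨ filter-++ P? D (x ∷ C) ⟩
  filter P? D ++ filter P? (x ∷ C)    ≡⟨ cong (filter P? D ++_) (filter-reject P? ¬Px) ⟩
  filter P? D ++ filter P? C          ≡⟨ filter-++ P? D C ⟨
  filter P? (D ++ C)                  ≡⟨ filter-reject P? ¬Px ⟨
  filter P? (x ∷ D ++ C)              ∎
  where open ≡-Reasoning
filter-move-left P? {x} D C (inj₂ ¬PD) = begin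
  filter P? (D ++ x ∷ C)              ≡⟨ filter-++ P? D (x ∷ C) ⟩
  filter P? D ++ filter P? (x ∷ C)    ≡⟨ cong (_++ filter P? (x ∷ C)) (filter-none P? ¬PD) ⟩
  filter P? ([ x ] ++ C)              ≡⟨ filter-++ P? [ x ] C ⟩
  filter P? [ x ] ++ filter P? C      ≡⟨ cong (λ ys → filter P? [ x ] ++ ys ++ filter P? C) (filter-none P? ¬PD) ⟨
  filter P? [ x ] ++ filter P? D ++ filter P? C ≡⟨ cong (filter P? [ x ] ++_) (filter-++ P? D C) ⟨
  filter P? [ x ] ++ filter P? (D ++ C) ≡⟨ filter-++ P? [ x ] (D ++ C) ⟨
  filter P? (x ∷ D ++ C)              ∎
  where open ≡-Reasoning

parityPart-move-left : ∀ b X D C {x} → Odd x → All Even D → parityPart b (X ++ D ++ x ∷ C) ≡ parityPart b (X ++ x ∷ D ++ C)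
parityPart-move-left b X D C {x} odd evens = begin
  parityPart b (X ++ D ++ x ∷ C)            ≡⟨ filter-++ _ X (D ++ x ∷ C) ⟩
  parityPart b X ++ parityPart b (D ++ x ∷ C) ≡⟨ cong (parityPart b X ++_) (filter-move-left _ D C (passes b)) ⟩
  parityPart b X ++ parityPart b (x ∷ D ++ C) ≡⟨ filter-++ _ X (x ∷ D ++ C) ⟨
  parityPart b (X ++ x ∷ D ++ C)            ∎
  where
  open ≡-Reasoning
  passes : ∀ b → isEven x ≢ b ⊎ All (λ y → isEven y ≢ b) D
  passes true = inj₁ (not-¬ odd)
  passes false = inj₂ (All.map (not-¬) evens)

take-length-++ : ∀ (A B : List ℕ) → take (length A) (A ++ B) ≡ A
take-length-++ [] B = refl
take-length-++ (a ∷ A) B = cong (a ∷_) (take-length-++ A B)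

drop-length-++ : ∀ (A B : List ℕ) → drop (length A) (A ++ B) ≡ B
drop-length-++ [] B = refl
drop-length-++ (a ∷ A) B = drop-length-++ A B

breakAt-++ : ∀ {x} X C → x ∉ X → breakAt x (X ++ x ∷ C) ≡ (X , C)
breakAt-++ {x} [] C _ with x ≟ x
... | yes _ = refl
... | no x≢x = ⊥-elim (x≢x refl)
breakAt-++ {x} (y ∷ X) C x∉ with y ≟ x
... | yes refl = ⊥-elim (x∉ (here refl))
... | no _ rewrite breakAt-++ X C (x∉ ∘ there) = refl

moveLeft-++ : ∀ {x} A B C → x ∉ A ++ B → moveLeft x (length B) ((A ++ B) ++ x ∷ C) ≡ A ++ x ∷ B ++ C
moveLeft-++ {x} A B C x∉ rewrite breakAt-++ (A ++ B) C x∉ | length-++ A {B} | m+n∸n≡m (length A) (length B)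
  | take-length-++ A B | drop-length-++ A B = refl

oddsFrom : ℕ → ℕ → List ℕ
oddsFrom i zero = []
oddsFrom i (suc j) = (2 * i ∸ 1) ∷ oddsFrom (suc i) j

-- Just before entry 2i-1 is moved, the list is  moved ++ block ++ 2i-1, 2i+1, …  where block
-- is the run of m even entries that 2i-3 passed over (all of 2, 4, …, 2n-2 when i = 1).
record Stage (i j m : ℕ) (L : List ℕ) : Set where
  field
    moved block  : List ℕ
    shape        : L ≡ moved ++ block ++ oddsFrom i j
    block-length : length block ≡ m
    block-even   : All Even block
    parts-sorted : ∀ b → AllPairs _<_ (parityPart b L)

∈-before : ∀ {a b} X {Y} → a ∈ X → b ∈ Y → Before a b (X ++ Y)
∈-before (_ ∷ X) (here refl) b∈Y = here (∈-++⁺ʳ X b∈Y)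
∈-before (_ ∷ X) (there a∈X) b∈Y = there (∈-before X a∈X b∈Y)

stage-step : ∀ {i j m m₀ L} → m₀ ≤ m → Stage (suc i) (suc j) m L →
             Stage (suc (suc i)) j m₀ (moveLeft (2 * suc i ∸ 1) m₀ L)
stage-step {i} {j} {m} {m₀} {L} m₀≤m stage = record
  { moved = (A ++ B₁) ++ [ x ]
  ; block = B₂
  ; shape = trans moved≡ (sym (++-assoc (A ++ B₁) [ x ] _))
  ; block-length = B₂-length
  ; block-even = All.drop⁺ (m ∸ m₀) block-even
  ; parts-sorted = λ b → subst (AllPairs _<_) (parts≡ b) (parts-sorted b)
  }
  where
  open Stage stage
  x = 2 * suc i ∸ 1
  C = oddsFrom (suc (suc i)) j
  A = moved
  B₁ = take (m ∸ m₀) block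
  B₂ = drop (m ∸ m₀) block
  B₂-length : length B₂ ≡ m₀
  B₂-length = trans (length-drop (m ∸ m₀) block) (trans (cong (_∸ (m ∸ m₀)) block-length) (m∸[m∸n]≡n m₀≤m))
  L≡ : L ≡ (A ++ B₁) ++ B₂ ++ x ∷ C
  L≡ = begin
    L                        ≡⟨ shape ⟩
    A ++ block ++ x ∷ C      ≡⟨ cong (λ Z → A ++ Z ++ x ∷ C) (take++drop≡id (m ∸ m₀) block) ⟨
    A ++ (B₁ ++ B₂) ++ x ∷ C ≡⟨ cong (A ++_) (++-assoc B₁ B₂ _) ⟩
    A ++ B₁ ++ B₂ ++ x ∷ C   ≡⟨ ++-assoc A B₁ _ ⟨
    (A ++ B₁) ++ B₂ ++ x ∷ C ∎
    where open ≡-Reasoning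
  L≡′ : L ≡ ((A ++ B₁) ++ B₂) ++ x ∷ C
  L≡′ = trans L≡ (sym (++-assoc (A ++ B₁) B₂ _))
  x∉ : x ∉ (A ++ B₁) ++ B₂
  x∉ x∈ = <-irrefl refl (paritySorted-from-parts parts-sorted (subst (Before x x) (sym L≡′) (∈-before _ x∈ (here refl))) refl)
  moved≡ : moveLeft x m₀ L ≡ (A ++ B₁) ++ x ∷ B₂ ++ C
  moved≡ = begin
    moveLeft x m₀ L                                    ≡⟨ cong₂ (moveLeft x) (sym B₂-length) L≡′ ⟩
    moveLeft x (length B₂) (((A ++ B₁) ++ B₂) ++ x ∷ C) ≡⟨ moveLeft-++ (A ++ B₁) B₂ C x∉ ⟩
    (A ++ B₁) ++ x ∷ B₂ ++ C                     ∎
    where open ≡-Reasoning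
  parts≡ : ∀ b → parityPart b L ≡ parityPart b (moveLeft x m₀ L)
  parts≡ b = trans (cong (parityPart b) L≡)
    (trans (parityPart-move-left b (A ++ B₁) B₂ C (isEven-odd-entry i) (All.drop⁺ (m ∸ m₀) block-even))
           (cong (parityPart b) (sym moved≡)))

HeadAtMost : ℕ → List ℕ → Set
HeadAtMost m [] = ⊤
HeadAtMost m (m₀ ∷ _) = m₀ ≤ m

staircase-head : ∀ {j μ} → PartitionInStaircase j μ → HeadAtMost j μ
staircase-head [] = tt
staircase-head (single _ m₀≤j) = m₀≤j
staircase-head ((_ , m₀≤j , _) ∷ _) = m₀≤j

moveAll-paritySorted : ∀ {i j m L μ} → PartitionInStaircase j μ → HeadAtMost m μ → Stage (suc i) j m L →
                       ParitySorted (moveAll (suc i) μ L)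
moveAll-paritySorted [] _ stage = paritySorted-from-parts (Stage.parts-sorted stage)
moveAll-paritySorted {j = zero} (single 1≤m₀ m₀≤0) = ⊥-elim (1+n≰n (≤-trans 1≤m₀ m₀≤0))
moveAll-paritySorted {j = suc _} (single _ _) m₀≤m stage = moveAll-paritySorted [] tt (stage-step m₀≤m stage)
moveAll-paritySorted {j = zero} ((1≤m₀ , m₀≤0 , _) ∷ _) = ⊥-elim (1+n≰n (≤-trans 1≤m₀ m₀≤0))
moveAll-paritySorted {j = suc _} ((_ , _ , m₁≤m₀) ∷ rest) m₀≤m stage = moveAll-paritySorted rest m₁≤m₀ (stage-step m₀≤m stage)

applyUpTo-oddsFrom : ∀ (f : ℕ → ℕ) i j → (∀ t → f t ≡ 2 * (i + t) ∸ 1) → applyUpTo f j ≡ oddsFrom i j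
applyUpTo-oddsFrom f i zero _ = refl
applyUpTo-oddsFrom f i (suc j) f≗ = cong₂ _∷_ (trans (f≗ 0) (cong (λ t → 2 * t ∸ 1) (+-identityʳ i)))
  (applyUpTo-oddsFrom (f ∘ suc) (suc i) j (λ t → trans (f≗ (suc t)) (cong (λ t → 2 * t ∸ 1) (+-suc i t))))

sorted-parityParts : ∀ {E O} → All Even E → All Odd O → AllPairs _<_ E → AllPairs _<_ O →
                     ∀ b → AllPairs _<_ (parityPart b (E ++ O))
sorted-parityParts {E} {O} evens odds E-sorted O-sorted true = subst (AllPairs _<_) (sym parts≡) E-sorted
  where
  parts≡ : parityPart true (E ++ O) ≡ E
  parts≡ = trans (filter-++ _ E O) (trans (cong₂ _++_ (filter-all _ evens) (filter-none _ (All.map not-¬ odds))) (++-identityʳ E))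
sorted-parityParts {E} {O} evens odds E-sorted O-sorted false = subst (AllPairs _<_) (sym parts≡) O-sorted
  where
  parts≡ : parityPart false (E ++ O) ≡ O
  parts≡ = trans (filter-++ _ E O) (cong₂ _++_ (filter-none _ (All.map not-¬ evens)) (filter-all _ odds))

wDelta-stage : ∀ n → Stage 1 (n ∸ 1) (n ∸ 1) (wDelta n)
wDelta-stage n = record
  { moved = []
  ; block = evens
  ; shape = cong (evens ++_) (trans odds≡ (applyUpTo-oddsFrom _ 1 k (λ _ → refl)))
  ; block-length = trans (length-map (2 *_) (idPerm k)) (trans (length-map suc (applyUpTo id k)) (length-applyUpTo id k))
  ; block-even = evens-even
  ; parts-sorted = sorted-parityParts evens-even
      (subst (All Odd) (sym odds≡) (All.applyUpTo⁺₂ _ k isEven-odd-entry))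
      (subst (AllPairs _<_) (sym evens≡) (AllPairs.applyUpTo⁺₁ _ k (λ i<j _ → *-monoʳ-< 2 (s≤s i<j))))
      (subst (AllPairs _<_) (sym odds≡) (AllPairs.applyUpTo⁺₁ _ k (λ i<j _ → ∸-monoˡ-< (*-monoʳ-< 2 (s≤s i<j)) (s≤s z≤n))))
  }
  where
  k = n ∸ 1
  evens = map (2 *_) (idPerm k)
  evens≡ : evens ≡ applyUpTo (λ t → 2 * suc t) k
  evens≡ = trans (cong (map (2 *_)) (map-applyUpTo id suc k)) (map-applyUpTo suc (2 *_) k)
  evens-even : All Even evens
  evens-even = subst (All Even) (sym evens≡) (All.applyUpTo⁺₂ _ k (isEven-double ∘ suc))
  odds≡ : map (λ t → 2 * t ∸ 1) (idPerm k) ≡ applyUpTo (λ t → 2 * suc t ∸ 1) k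
  odds≡ = trans (cong (map (λ t → 2 * t ∸ 1)) (map-applyUpTo id suc k)) (map-applyUpTo suc (λ t → 2 * t ∸ 1) k)

wSkew-paritySorted : ∀ n μ → PartitionIn-δ n μ → ParitySorted (wSkew n μ)
wSkew-paritySorted n μ μ⊆δ = moveAll-paritySorted μ⊆δ (staircase-head μ⊆δ) (wDelta-stage n)

proposition3p5 : (n : ℕ) → 2 ≤ n → (μ : List ℕ) → PartitionIn-δ n μ →
    (u v : List ℕ) → IsReducedWord (wSkew n μ) u → ShiftedKnuthMove u v →
    IsReducedWord (wSkew n μ) v
proposition3p5 n _ μ μ⊆δ u v = shiftedKnuthMove-preserves-reduced (wSkew-paritySorted n μ μ⊆δ)
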